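{- Let $F=\mathbb{F}_q$ with $q$ odd, let $\rho$ be a nontrivial automorphism of $F$ with $-1\notin\{x^{\rho-1}\mid x\in F^*\}$, and let $\beta:F\to F$ be the inverse of the bijection $u\mapsto u^{\rho^{ -1}}+u^{\rho}$. Let $\Sigma$ consist of $\{(0,y)\mid y\in F\}$ and $W_m=\{(x,mx^{\rho^{ -1}}+m^{\rho}x^{\rho})\mid x\in F\}$, $m\in F$. Let $\sigma_s(v,w)=(sv,s^{ -1}w)$ for $s\in F^*$, $\tau(v,w)=(w,v)$, $\mathcal{N}=\{\sigma_s(W_1)\mid s\in F^*\}$, $\mathcal{N}'=\{\tau(U)\mid U\in\mathcal{N}\}$, and $\Sigma'=(\Sigma\setminus\mathcal{N})\cup\mathcal{N}'$. Then $\Sigma'$ consists exactly of the subspaces $\{(x,0)\mid x\in F\}$; $\{(0,y)\mid y\in F\}$; $W_m$ for nonsquare $m\in F^*$; and $\{(x,s\beta(xs))\mid x\in F\}$ for $s$ ranging over $F^*/\langle -1\rangle$ (i.e. one $s$ from each pair $\{s,-s\}$).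
   Context: $x^{\rho^k}$ denotes the image of $x$ under $\rho^k$, and $x^{\rho-1}=x^{\rho}/x$. -}

module Defs where

open import Level using (Level; _⊔_; suc)
open import Algebra.Bundles using (CommutativeRing)
open import Data.Nat using (ℕ; _%_)
open import Data.Fin using (Fin)
open import Data.Product using (Σ; _×_; _,_)
open import Data.Sum using (_⊎_)
open import Relation.Nullary using (¬_)
open import Relation.Binary.PropositionalEquality using (_≡_)

-- A field: a commutative ring with 0 ≠ 1 in which every nonzero element
-- has a multiplicative inverse (the value of _⁻¹ at 0 is irrelevant).
record IsField {c ℓ} (R : CommutativeRing c ℓ) : Set (c ⊔ ℓ) where
  open CommutativeRing R
  field
    0≉1      : ¬ (0# ≈ 1#)
    _⁻¹      : Carrier → Carrier
    ⁻¹-cong  : ∀ {x y} → x ≈ y → (x ⁻¹) ≈ (y ⁻¹)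
    inverseʳ : ∀ x → ¬ (x ≈ 0#) → (x * (x ⁻¹)) ≈ 1#

module FieldDefs {c ℓ} (R : CommutativeRing c ℓ) (K : IsField R) where
  open CommutativeRing R
  open IsField K

  FiniteOfOddOrder : Set (c ⊔ ℓ)
  FiniteOfOddOrder =
    Σ ℕ λ q → (q % 2 ≡ 1) × Σ (Fin q → Carrier) λ e →
      (∀ i j → e i ≈ e j → i ≡ j) × (∀ x → Σ (Fin q) λ i → e i ≈ x)

  record IsAutomorphism (ρ ρinv : Carrier → Carrier) : Set (c ⊔ ℓ) where
    field
      cong     : ∀ {x y} → x ≈ y → ρ x ≈ ρ y
      +-homo   : ∀ x y → ρ (x + y) ≈ (ρ x + ρ y)
      *-homo   : ∀ x y → ρ (x * y) ≈ (ρ x * ρ y)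
      1-homo   : ρ 1# ≈ 1#
      inv-cong : ∀ {x y} → x ≈ y → ρinv x ≈ ρinv y
      inverseˡ : ∀ x → ρinv (ρ x) ≈ x
      inverseʳ : ∀ x → ρ (ρinv x) ≈ x

  Nontrivial : (Carrier → Carrier) → Set (c ⊔ ℓ)
  Nontrivial ρ = Σ Carrier λ x → ¬ (ρ x ≈ x)

  MinusOneNotRhoMinusOne : (Carrier → Carrier) → Set (c ⊔ ℓ)
  MinusOneNotRhoMinusOne ρ = ∀ x → ¬ (x ≈ 0#) → ¬ ((ρ x * (x ⁻¹)) ≈ (- 1#))

  IsSquare : Carrier → Set (c ⊔ ℓ)
  IsSquare m = Σ Carrier λ y → (y * y) ≈ m

  Sub : Set (suc (c ⊔ ℓ))
  Sub = Carrier → Carrier → Set (c ⊔ ℓ)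

  _≐_ : Sub → Sub → Set (c ⊔ ℓ)
  U ≐ V = ∀ v w → (U v w → V v w) × (V v w → U v w)

  Xaxis : Sub
  Xaxis v w = Σ Carrier λ x → (v ≈ x) × (w ≈ 0#)

  Yaxis : Sub
  Yaxis v w = Σ Carrier λ y → (v ≈ 0#) × (w ≈ y)

  module _ (ρ ρinv : Carrier → Carrier) where
    W : Carrier → Sub
    W m v w = Σ Carrier λ x → (v ≈ x) × (w ≈ ((m * ρinv x) + (ρ m * ρ x)))

    σ : Carrier → Sub → Sub
    σ s U v w = Σ Carrier λ v′ → Σ Carrier λ w′ →
      U v′ w′ × (v ≈ (s * v′)) × (w ≈ ((s ⁻¹) * w′))

    τ : Sub → Sub
    τ U v w = Σ Carrier λ v′ → Σ Carrier λ w′ →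
      U v′ w′ × (v ≈ w′) × (w ≈ v′)

    InΣ : Sub → Set (c ⊔ ℓ)
    InΣ U = (U ≐ Yaxis) ⊎ (Σ Carrier λ m → U ≐ W m)

    InN : Sub → Set (c ⊔ ℓ)
    InN U = Σ Carrier λ s → ¬ (s ≈ 0#) × (U ≐ σ s (W 1#))

    InN′ : Sub → Set (suc (c ⊔ ℓ))
    InN′ U = Σ Sub λ V → InN V × (U ≐ τ V)

    InΣ′ : Sub → Set (suc (c ⊔ ℓ))
    InΣ′ U = (InΣ U × ¬ InN U) ⊎ InN′ U

    module _ (β : Carrier → Carrier) where
      G : Carrier → Sub
      G s v w = Σ Carrier λ x → (v ≈ x) × (w ≈ (s * β (x * s)))

      Listed : Sub → Set (c ⊔ ℓ)
      Listed U =
        (U ≐ Xaxis) ⊎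
        (U ≐ Yaxis) ⊎
        (Σ Carrier λ m → ¬ (m ≈ 0#) × ¬ IsSquare m × (U ≐ W m)) ⊎
        (Σ Carrier λ s → ¬ (s ≈ 0#) × (U ≐ G s))

-- Writing N(s) = s ρ⁻¹(s), one computes σ_s(W₁) = W_{N(s⁻¹)} and τσ_s(W₁) = {(x, s β(x s))}.
-- In the multiplicative group of the finite field both the squares and the values of N form
-- subgroups of index two: x ↦ x² and N are even multiplicative maps with kernel {±1} (for N
-- because -1 is not of the form x^{ρ-1}), so their images have exactly half the size.  As ρ⁻¹
-- maps nonsquares to nonsquares, every value of N is a square, hence the two subgroups agree.
-- So 𝒩 consists exactly of the W_m with m a nonzero square; since m ↦ W_m is injective, what
-- remains of Σ is the y-axis, W₀ (the x-axis) and the W_m with m a nonsquare.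

module Submission where

open import Algebra.Bundles using (CommutativeRing)
open import Data.Fin as Fin using (Fin)
import Data.Fin.Properties as Finₚ
open import Data.Nat as ℕ using (ℕ)
import Data.Nat.Properties as ℕₚ
open import Data.Product using (∃; ∃₂; _×_; _,_; proj₁; proj₂)
open import Data.Sum using (_⊎_; inj₁; inj₂)
open import Function using (_∘_)
open import Level using (_⊔_)
open import Relation.Binary.Bundles using (Setoid)
open import Relation.Binary.Definitions using (Decidable; _Respects_; tri<; tri≈; tri>)
open import Relation.Binary.PropositionalEquality as ≡ using (_≡_; _≢_)
import Relation.Binary.Reasoning.Setoid as SetoidReasoning
open import Relation.Nullary using (¬_; Dec; yes; no; contradiction)
open import Relation.Nullary.Decidable as Dec using (_×-dec_; ¬?)

open import Defs

-- Finite sets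

Fin-injective⇒surjective : ∀ {n} (h : Fin n → Fin n) →
  (∀ {i i′} → h i ≡ h i′ → i ≡ i′) → ∀ j → ∃ λ i → h i ≡ j
Fin-injective⇒surjective {ℕ.zero}  h h-inj ()
Fin-injective⇒surjective {ℕ.suc n} h h-inj j with Finₚ.any? (λ i → h i Fin.≟ j)
... | yes hit = hit
... | no miss = collision (Finₚ.pigeonhole (ℕₚ.n<1+n n) (λ i → Fin.punchOut (avoid i)))
  where
  avoid : ∀ i → j ≢ h i
  avoid i j≡hi = miss (i , ≡.sym j≡hi)
  collision : (∃₂ λ i i′ → i Fin.< i′ × Fin.punchOut (avoid i) ≡ Fin.punchOut (avoid i′)) →
              ∃ λ i → h i ≡ j
  collision (i , i′ , i<i′ , eq) =
    contradiction (h-inj (Finₚ.punchOut-injective (avoid i) (avoid i′) eq)) (Finₚ.<⇒≢ i<i′)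

Fin-surjective⇒injective : ∀ {n} (h : Fin n → Fin n) →
  (∀ j → ∃ λ i → h i ≡ j) → ∀ {i i′} → h i ≡ h i′ → i ≡ i′
Fin-surjective⇒injective {n} h h-surj {i} {i′} hi≡hi′ = begin
  i          ≡⟨ ≡.sym (g∘h i) ⟩
  g (h i)    ≡⟨ ≡.cong g hi≡hi′ ⟩
  g (h i′)   ≡⟨ g∘h i′ ⟩
  i′         ∎
  where
  open ≡.≡-Reasoning
  g : Fin n → Fin n
  g j = proj₁ (h-surj j)
  h∘g : ∀ j → h (g j) ≡ j
  h∘g j = proj₂ (h-surj j)
  g∘h : ∀ i → g (h i) ≡ i
  g∘h i with j , gj≡i ← Fin-injective⇒surjective g
                          (λ {j} {j′} gj≡gj′ → ≡.trans (≡.sym (h∘g j)) (≡.trans (≡.cong h gj≡gj′) (h∘g j′))) i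
    = ≡.trans (≡.cong (g ∘ h) (≡.sym gj≡i)) (≡.trans (≡.cong g (h∘g j)) gj≡i)

module FiniteSetoid {a ℓ} (S : Setoid a ℓ) {n : ℕ} (e : Fin n → Setoid.Carrier S)
  (e-injective : ∀ i j → Setoid._≈_ S (e i) (e j) → i ≡ j)
  (e-surjective : ∀ x → ∃ λ i → Setoid._≈_ S (e i) x) where

  open Setoid S

  index : Carrier → Fin n
  index x = proj₁ (e-surjective x)

  e-index : ∀ x → e (index x) ≈ x
  e-index x = proj₂ (e-surjective x)

  index-e : ∀ i → index (e i) ≡ i
  index-e i = e-injective _ _ (e-index (e i))

  index-cong : ∀ {x y} → x ≈ y → index x ≡ index y
  index-cong {x} {y} x≈y = e-injective _ _ (trans (e-index x) (trans x≈y (sym (e-index y))))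

  index-injective : ∀ {x y} → index x ≡ index y → x ≈ y
  index-injective {x} {y} eq = trans (sym (e-index x)) (trans (reflexive (≡.cong e eq)) (e-index y))

  infix 4 _≟_
  _≟_ : Decidable _≈_
  x ≟ y = Dec.map′ index-injective index-cong (index x Fin.≟ index y)

  any? : ∀ {p} {P : Carrier → Set p} → P Respects _≈_ → (∀ x → Dec (P x)) → Dec (∃ P)
  any? resp P? = Dec.map′ (λ (i , p) → e i , p) (λ (x , p) → index x , resp (sym (e-index x)) p)
                          (Finₚ.any? (P? ∘ e))

  module _ (h : Carrier → Carrier) where

    private
      ĥ : Fin n → Fin n
      ĥ i = index (h (e i))

    injective⇒surjective : (∀ {x y} → h x ≈ h y → x ≈ y) → ∀ y → ∃ λ x → h x ≈ y
    injective⇒surjective h-inj y =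
      let i , ĥi≡ = Fin-injective⇒surjective ĥ (λ eq → e-injective _ _ (h-inj (index-injective eq))) (index y)
      in e i , index-injective ĥi≡

    surjective⇒injective : (∀ {x y} → x ≈ y → h x ≈ h y) → (∀ y → ∃ λ x → h x ≈ y) →
                           ∀ {x y} → h x ≈ h y → x ≈ y
    surjective⇒injective h-cong h-surj {x} {y} hx≈hy =
      index-injective (Fin-surjective⇒injective ĥ ĥ-surj (index-cong (begin
        h (e (index x))  ≈⟨ h-cong (e-index x) ⟩
        h x              ≈⟨ hx≈hy ⟩
        h y              ≈⟨ h-cong (e-index y) ⟨
        h (e (index y))  ∎)))
      where
      open SetoidReasoning S
      ĥ-surj : ∀ j → ∃ λ i → ĥ i ≡ j
      ĥ-surj j = let x , hx≈ej = h-surj (e j)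
                 in index x , ≡.trans (index-cong (trans (h-cong (e-index x)) hx≈ej)) (index-e j)

  module Representatives (ι : Carrier → Carrier) (ι-cong : ∀ {x y} → x ≈ y → ι x ≈ ι y)
                         (ι-involutive : ∀ x → ι (ι x) ≈ x) where

    Preferred : Carrier → Set
    Preferred x = index x Fin.< index (ι x)

    preferred? : ∀ x → Dec (Preferred x)
    preferred? x = index x Finₚ.<? index (ι x)

    Preferred-resp : Preferred Respects _≈_
    Preferred-resp x≈y = ≡.subst₂ Fin._<_ (index-cong x≈y) (index-cong (ι-cong x≈y))

    ¬Preferred-both : ∀ {x} → Preferred x → ¬ Preferred (ι x)
    ¬Preferred-both {x} px pιx =
      Finₚ.<-asym px (≡.subst (index (ι x) Fin.<_) (index-cong (ι-involutive x)) pιx)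

    preferred-or-ι : ∀ {x} → ¬ (x ≈ ι x) → Preferred x ⊎ Preferred (ι x)
    preferred-or-ι {x} x≉ιx with Finₚ.<-cmp (index x) (index (ι x))
    ... | tri< x<ιx _ _ = inj₁ x<ιx
    ... | tri≈ _ x≡ιx _ = contradiction (index-injective x≡ιx) x≉ιx
    ... | tri> _ _ ιx<x = inj₂ (≡.subst (index (ι x) Fin.<_) (≡.sym (index-cong (ι-involutive x))) ιx<x)

-- Fields and their automorphisms

module FieldProperties {c ℓ} (R : CommutativeRing c ℓ) (K : IsField R) where

  open CommutativeRing R
  open IsField K
  open FieldDefs R K
  open import Algebra.Properties.Ring ring
    using (-‿involutive; -‿distribˡ-*; -‿distribʳ-*; -‿+-comm; -1*x≈-x; x+x≈x⇒x≈0;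
           +-inverseˡ-unique; +-inverseʳ-unique; x∙y⁻¹≈ε⇒x≈y; x≈y⇒x∙y⁻¹≈ε; ⁻¹-anti-homo‿-)
  open import Relation.Binary.Reasoning.Setoid setoid
  open import Algebra.Solver.Ring.NaturalCoefficients.Default commutativeSemiring
    using (solve; _:+_; _:*_; _:=_)

  1≉0 : 1# ≉ 0#
  1≉0 1≈0 = 0≉1 (sym 1≈0)

  inverseˡ : ∀ {x} → x ≉ 0# → x ⁻¹ * x ≈ 1#
  inverseˡ {x} x≉0 = trans (*-comm _ _) (inverseʳ x x≉0)

  *-cancelˡ : ∀ {x y z} → x ≉ 0# → x * y ≈ x * z → y ≈ z
  *-cancelˡ {x} {y} {z} x≉0 xy≈xz = begin
    y                ≈⟨ *-identityˡ y ⟨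
    1# * y           ≈⟨ *-congʳ (inverseˡ x≉0) ⟨
    (x ⁻¹ * x) * y   ≈⟨ *-assoc _ _ _ ⟩
    x ⁻¹ * (x * y)   ≈⟨ *-congˡ xy≈xz ⟩
    x ⁻¹ * (x * z)   ≈⟨ *-assoc _ _ _ ⟨
    (x ⁻¹ * x) * z   ≈⟨ *-congʳ (inverseˡ x≉0) ⟩
    1# * z           ≈⟨ *-identityˡ z ⟩
    z                ∎

  *-nonzero : ∀ {x y} → x ≉ 0# → y ≉ 0# → x * y ≉ 0#
  *-nonzero {x} {y} x≉0 y≉0 xy≈0 = y≉0 (*-cancelˡ x≉0 (trans xy≈0 (sym (zeroʳ x))))

  x*x≈y⇒x≉0 : ∀ {x y} → y ≉ 0# → x * x ≈ y → x ≉ 0#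
  x*x≈y⇒x≉0 {x} y≉0 xx≈y x≈0 = y≉0 (trans (sym xx≈y) (trans (*-congʳ x≈0) (zeroˡ x)))

  x*y≈1⇒x≉0 : ∀ {x y} → x * y ≈ 1# → x ≉ 0#
  x*y≈1⇒x≉0 {x} {y} xy≈1 x≈0 = 0≉1 (trans (sym (zeroˡ y)) (trans (*-congʳ (sym x≈0)) xy≈1))

  x*y≈1⇒y≈x⁻¹ : ∀ {x y} → x * y ≈ 1# → y ≈ x ⁻¹
  x*y≈1⇒y≈x⁻¹ {x} xy≈1 = *-cancelˡ x≉0 (trans xy≈1 (sym (inverseʳ x x≉0)))
    where
    x≉0 : x ≉ 0#
    x≉0 = x*y≈1⇒x≉0 xy≈1

  ⁻¹-nonzero : ∀ {x} → x ≉ 0# → x ⁻¹ ≉ 0#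
  ⁻¹-nonzero {x} x≉0 x⁻¹≈0 = 0≉1 (trans (sym (zeroʳ x)) (trans (*-congˡ (sym x⁻¹≈0)) (inverseʳ x x≉0)))

  ⁻¹-involutive : ∀ {x} → x ≉ 0# → x ⁻¹ ⁻¹ ≈ x
  ⁻¹-involutive x≉0 = sym (x*y≈1⇒y≈x⁻¹ (inverseˡ x≉0))

  x≈[x*y⁻¹]*y : ∀ {x y} → y ≉ 0# → x ≈ (x * y ⁻¹) * y
  x≈[x*y⁻¹]*y {x} {y} y≉0 = begin
    x                ≈⟨ *-identityʳ x ⟨
    x * 1#           ≈⟨ *-congˡ (inverseˡ y≉0) ⟨
    x * (y ⁻¹ * y)   ≈⟨ *-assoc _ _ _ ⟨
    (x * y ⁻¹) * y   ∎

  -x*-y≈x*y : ∀ x y → - x * - y ≈ x * y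
  -x*-y≈x*y x y = begin
    - x * - y      ≈⟨ -‿distribˡ-* x (- y) ⟨
    - (x * - y)    ≈⟨ -‿cong (-‿distribʳ-* x y) ⟨
    - (- (x * y))  ≈⟨ -‿involutive _ ⟩
    x * y          ∎

  x≉-x : 1# ≉ - 1# → ∀ {x} → x ≉ 0# → x ≉ - x
  x≉-x 1≉-1 {x} x≉0 x≈-x = 1≉-1 (*-cancelˡ x≉0 (begin
    x * 1#     ≈⟨ *-identityʳ x ⟩
    x          ≈⟨ x≈-x ⟩
    - x        ≈⟨ -‿cong (*-identityʳ x) ⟨
    - (x * 1#) ≈⟨ -‿distribʳ-* x 1# ⟩
    x * - 1#   ∎))

  x*[x⁻¹*y]≈y : ∀ {x} → x ≉ 0# → ∀ y → x * (x ⁻¹ * y) ≈ y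
  x*[x⁻¹*y]≈y {x} x≉0 y = begin
    x * (x ⁻¹ * y)  ≈⟨ *-assoc _ _ _ ⟨
    (x * x ⁻¹) * y  ≈⟨ *-congʳ (inverseʳ x x≉0) ⟩
    1# * y          ≈⟨ *-identityˡ y ⟩
    y               ∎

  x⁻¹*[x*y]≈y : ∀ {x} → x ≉ 0# → ∀ y → x ⁻¹ * (x * y) ≈ y
  x⁻¹*[x*y]≈y {x} x≉0 y = trans (sym (*-assoc _ _ _)) (trans (*-congʳ (inverseˡ x≉0)) (*-identityˡ y))

  [x*y]*[x*y]≈[x*x]*[y*y] : ∀ x y → (x * y) * (x * y) ≈ (x * x) * (y * y)
  [x*y]*[x*y]≈[x*x]*[y*y] = solve 2 (λ x y → (x :* y) :* (x :* y) := (x :* x) :* (y :* y)) refl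

  quotient-isSquare : ∀ {a b x} → a ≉ 0# → x * (a * a) ≈ b * b → IsSquare x
  quotient-isSquare {a} {b} {x} a≉0 x*aa≈bb = b * a ⁻¹ , (begin
    (b * a ⁻¹) * (b * a ⁻¹)           ≈⟨ [x*y]*[x*y]≈[x*x]*[y*y] b (a ⁻¹) ⟩
    (b * b) * (a ⁻¹ * a ⁻¹)           ≈⟨ *-congʳ x*aa≈bb ⟨
    (x * (a * a)) * (a ⁻¹ * a ⁻¹)     ≈⟨ solve 3 (λ x a i → (x :* (a :* a)) :* (i :* i) := x :* ((a :* i) :* (a :* i))) refl x a (a ⁻¹) ⟩
    x * ((a * a ⁻¹) * (a * a ⁻¹))     ≈⟨ *-congˡ (*-cong (inverseʳ a a≉0) (inverseʳ a a≉0)) ⟩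
    x * (1# * 1#)                     ≈⟨ *-congˡ (*-identityˡ 1#) ⟩
    x * 1#                            ≈⟨ *-identityʳ x ⟩
    x                                 ∎)

  [a-b]+[c-d]≈[a+c]-[b+d] : ∀ a b c d → (a - b) + (c - d) ≈ (a + c) - (b + d)
  [a-b]+[c-d]≈[a+c]-[b+d] a b c d = begin
    (a - b) + (c - d)      ≈⟨ solve 4 (λ a b c d → (a :+ b) :+ (c :+ d) := (a :+ c) :+ (b :+ d)) refl a (- b) c (- d) ⟩
    (a + c) + (- b + - d)  ≈⟨ +-congˡ (-‿+-comm b d) ⟩
    (a + c) - (b + d)      ∎

  sub-injective : (φ : Carrier → Carrier) → (∀ x y → φ (x - y) ≈ φ x - φ y) →
                  (∀ {x} → φ x ≈ 0# → x ≈ 0#) → ∀ {x y} → φ x ≈ φ y → x ≈ y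
  sub-injective φ φ-sub φ≈0⇒≈0 {x} {y} φx≈φy =
    x∙y⁻¹≈ε⇒x≈y x y (φ≈0⇒≈0 (trans (φ-sub x y) (x≈y⇒x∙y⁻¹≈ε φx≈φy)))

  module AutomorphismProperties {ρ ρinv : Carrier → Carrier} (A : IsAutomorphism ρ ρinv) where

    open IsAutomorphism A public
      renaming (cong to ρ-cong; +-homo to ρ-+; *-homo to ρ-*; 1-homo to ρ-1;
                inverseˡ to ρinv∘ρ; inverseʳ to ρ∘ρinv)

    ρ-injective : ∀ {x y} → ρ x ≈ ρ y → x ≈ y
    ρ-injective {x} {y} ρx≈ρy = trans (sym (ρinv∘ρ x)) (trans (inv-cong ρx≈ρy) (ρinv∘ρ y))

    ρ-0 : ρ 0# ≈ 0#
    ρ-0 = x+x≈x⇒x≈0 (ρ 0#) (trans (sym (ρ-+ 0# 0#)) (ρ-cong (+-identityˡ 0#)))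

    ρ-nonzero : ∀ {x} → x ≉ 0# → ρ x ≉ 0#
    ρ-nonzero x≉0 ρx≈0 = x≉0 (ρ-injective (trans ρx≈0 (sym ρ-0)))

    ρ-neg : ∀ x → ρ (- x) ≈ - ρ x
    ρ-neg x = +-inverseʳ-unique (ρ x) (ρ (- x))
      (trans (sym (ρ-+ x (- x))) (trans (ρ-cong (-‿inverseʳ x)) ρ-0))

    ρ-sub : ∀ x y → ρ (x - y) ≈ ρ x - ρ y
    ρ-sub x y = trans (ρ-+ x (- y)) (+-congˡ (ρ-neg y))

    ρinv-anti⇒ρ-anti : ∀ {z} → ρinv z ≈ - z → ρ z ≈ - z
    ρinv-anti⇒ρ-anti {z} ρinv-z≈-z = begin
      ρ z             ≈⟨ -‿involutive (ρ z) ⟨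
      - (- ρ z)       ≈⟨ -‿cong (ρ-neg z) ⟨
      - ρ (- z)       ≈⟨ -‿cong (ρ-cong ρinv-z≈-z) ⟨
      - ρ (ρinv z)    ≈⟨ -‿cong (ρ∘ρinv z) ⟩
      - z             ∎

    ρ-⁻¹ : ∀ {x} → x ≉ 0# → ρ (x ⁻¹) ≈ ρ x ⁻¹
    ρ-⁻¹ {x} x≉0 = x*y≈1⇒y≈x⁻¹ (trans (sym (ρ-* x (x ⁻¹))) (trans (ρ-cong (inverseʳ x x≉0)) ρ-1))

  inverse-isAutomorphism : ∀ {ρ ρinv} → IsAutomorphism ρ ρinv → IsAutomorphism ρinv ρ
  inverse-isAutomorphism {ρ} {ρinv} A = record
    { cong     = inv-cong
    ; +-homo   = λ x y → homo _+_ ρ-+ +-cong x y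
    ; *-homo   = λ x y → homo _*_ ρ-* *-cong x y
    ; 1-homo   = trans (inv-cong (sym ρ-1)) (ρinv∘ρ 1#)
    ; inv-cong = ρ-cong
    ; inverseˡ = ρ∘ρinv
    ; inverseʳ = ρinv∘ρ
    }
    where
    open IsAutomorphism A renaming (cong to ρ-cong; +-homo to ρ-+; *-homo to ρ-*; 1-homo to ρ-1;
                                inverseˡ to ρinv∘ρ; inverseʳ to ρ∘ρinv)
    homo : (_∙_ : Carrier → Carrier → Carrier) → (∀ x y → ρ (x ∙ y) ≈ ρ x ∙ ρ y) →
           (∀ {x x′ y y′} → x ≈ x′ → y ≈ y′ → (x ∙ y) ≈ (x′ ∙ y′)) →
           ∀ x y → ρinv (x ∙ y) ≈ ρinv x ∙ ρinv y
    homo _∙_ ρ-∙ ∙-cong x y = begin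
      ρinv (x ∙ y)                    ≈⟨ inv-cong (∙-cong (ρ∘ρinv x) (ρ∘ρinv y)) ⟨
      ρinv (ρ (ρinv x) ∙ ρ (ρinv y))  ≈⟨ inv-cong (ρ-∙ _ _) ⟨
      ρinv (ρ (ρinv x ∙ ρinv y))      ≈⟨ ρinv∘ρ _ ⟩
      ρinv x ∙ ρinv y                 ∎

  -- Subsets of F × F

  ≐-refl : ∀ {U} → U ≐ U
  ≐-refl v w = (λ u → u) , (λ u → u)

  ≐-sym : ∀ {U V} → U ≐ V → V ≐ U
  ≐-sym U≐V v w = proj₂ (U≐V v w) , proj₁ (U≐V v w)

  ≐-trans : ∀ {U V X} → U ≐ V → V ≐ X → U ≐ X
  ≐-trans U≐V V≐X v w = proj₁ (V≐X v w) ∘ proj₁ (U≐V v w) , proj₂ (U≐V v w) ∘ proj₂ (V≐X v w)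

  Graph : (Carrier → Carrier) → Sub
  Graph φ v w = ∃ λ x → (v ≈ x) × (w ≈ φ x)

  graph-cong : ∀ {φ ψ} → (∀ x → φ x ≈ ψ x) → Graph φ ≐ Graph ψ
  graph-cong φ≈ψ v w = (λ (x , v≈x , w≈φx) → x , v≈x , trans w≈φx (φ≈ψ x))
                     , (λ (x , v≈x , w≈ψx) → x , v≈x , trans w≈ψx (sym (φ≈ψ x)))

  graph-≐⇒≈ : ∀ {φ ψ} → (∀ {x y} → x ≈ y → ψ x ≈ ψ y) → Graph φ ≐ Graph ψ → ∀ x → φ x ≈ ψ x
  graph-≐⇒≈ ψ-cong Gφ≐Gψ x with x′ , x≈x′ , φx≈ψx′ ← proj₁ (Gφ≐Gψ x _) (x , refl , refl) =
    trans φx≈ψx′ (ψ-cong (sym x≈x′))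

  -- σ and τ ignore their arguments ρ and ρinv.
  module _ (ρ ρinv : Carrier → Carrier) where

    τ-cong : ∀ {U V} → U ≐ V → τ ρ ρinv U ≐ τ ρ ρinv V
    τ-cong U≐V v w = (λ (v′ , w′ , u , v≈w′ , w≈v′) → v′ , w′ , proj₁ (U≐V v′ w′) u , v≈w′ , w≈v′)
                   , (λ (v′ , w′ , u , v≈w′ , w≈v′) → v′ , w′ , proj₂ (U≐V v′ w′) u , v≈w′ , w≈v′)

    σ-graph : ∀ {s φ} → s ≉ 0# → (∀ {x y} → x ≈ y → φ x ≈ φ y) →
              σ ρ ρinv s (Graph φ) ≐ Graph (λ x → s ⁻¹ * φ (s ⁻¹ * x))
    σ-graph {s} {φ} s≉0 φ-cong v w = to , from
      where
      to : σ ρ ρinv s (Graph φ) v w → Graph (λ x → s ⁻¹ * φ (s ⁻¹ * x)) v w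
      to (v′ , w′ , (x , v′≈x , w′≈φx) , v≈sv′ , w≈s⁻¹w′) = v , refl , (begin
        w                   ≈⟨ w≈s⁻¹w′ ⟩
        s ⁻¹ * w′           ≈⟨ *-congˡ w′≈φx ⟩
        s ⁻¹ * φ x          ≈⟨ *-congˡ (φ-cong s⁻¹v≈x) ⟨
        s ⁻¹ * φ (s ⁻¹ * v) ∎)
        where
        s⁻¹v≈x : s ⁻¹ * v ≈ x
        s⁻¹v≈x = trans (*-congˡ v≈sv′) (trans (x⁻¹*[x*y]≈y s≉0 v′) v′≈x)
      from : Graph (λ x → s ⁻¹ * φ (s ⁻¹ * x)) v w → σ ρ ρinv s (Graph φ) v w
      from (x , v≈x , w≈) = s ⁻¹ * x , φ (s ⁻¹ * x) , (s ⁻¹ * x , refl , refl)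
                          , trans v≈x (sym (x*[x⁻¹*y]≈y s≉0 x)) , w≈

    τ-graph : ∀ {φ χ} → (∀ {x y} → x ≈ y → χ x ≈ χ y) →
              (∀ x → φ (χ x) ≈ x) → (∀ x → χ (φ x) ≈ x) → τ ρ ρinv (Graph φ) ≐ Graph χ
    τ-graph {φ} {χ} χ-cong φ∘χ χ∘φ v w =
        (λ (v′ , w′ , (x , v′≈x , w′≈φx) , v≈w′ , w≈v′) →
          v , refl , trans w≈v′ (trans v′≈x (trans (sym (χ∘φ x)) (χ-cong (sym (trans v≈w′ w′≈φx))))))
      , (λ (x , v≈x , w≈χx) → w , v , (χ x , w≈χx , trans v≈x (sym (φ∘χ x))) , refl , refl)

  -- Finite fields

  module FiniteFieldProperties (fin : FiniteOfOddOrder) where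

    open FiniteSetoid setoid (proj₁ (proj₂ (proj₂ fin))) (proj₁ (proj₂ (proj₂ (proj₂ fin))))
                             (proj₂ (proj₂ (proj₂ (proj₂ fin))))
      using (_≟_; any?; injective⇒surjective; surjective⇒injective; module Representatives)

    x*y≈0⇒x≈0⊎y≈0 : ∀ {x y} → x * y ≈ 0# → x ≈ 0# ⊎ y ≈ 0#
    x*y≈0⇒x≈0⊎y≈0 {x} {y} xy≈0 with x ≟ 0#
    ... | yes x≈0 = inj₁ x≈0
    ... | no  x≉0 = inj₂ (*-cancelˡ x≉0 (trans xy≈0 (sym (zeroʳ x))))

    -- Cancel x + y in (x + y) x ≈ (x + y) y.
    x*x≈y*y⇒x≈±y : ∀ {x y} → x * x ≈ y * y → x ≈ y ⊎ x ≈ - y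
    x*x≈y*y⇒x≈±y {x} {y} xx≈yy with (x + y) ≟ 0#
    ... | yes x+y≈0 = inj₂ (+-inverseˡ-unique x y x+y≈0)
    ... | no  x+y≉0 = inj₁ (*-cancelˡ x+y≉0 (begin
      (x + y) * x      ≈⟨ distribʳ x x y ⟩
      x * x + y * x    ≈⟨ +-cong xx≈yy (*-comm y x) ⟩
      y * y + x * y    ≈⟨ +-comm _ _ ⟩
      x * y + y * y    ≈⟨ distribʳ y x y ⟨
      (x + y) * y      ∎))

    -- The image of such an h is a subgroup of index two in the multiplicative group.
    module IndexTwo (1≉-1 : 1# ≉ - 1#) (h : Carrier → Carrier)
      (h-cong : ∀ {x y} → x ≈ y → h x ≈ h y)
      (h-* : ∀ x y → h (x * y) ≈ h x * h y)
      (h-1 : h 1# ≈ 1#)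
      (h-0 : h 0# ≈ 0#)
      (h-nonzero : ∀ {x} → x ≉ 0# → h x ≉ 0#)
      (h-neg : ∀ x → h (- x) ≈ h x)
      (h≈1⇒≈±1 : ∀ {t} → t ≉ 0# → h t ≈ 1# → t ≈ 1# ⊎ t ≈ - 1#) where

      h-⁻¹ : ∀ {y} → y ≉ 0# → h y * h (y ⁻¹) ≈ 1#
      h-⁻¹ {y} y≉0 = trans (sym (h-* y (y ⁻¹))) (trans (h-cong (inverseʳ y y≉0)) h-1)

      h≈⇒h[x*y⁻¹]≈1 : ∀ {x y} → y ≉ 0# → h x ≈ h y → h (x * y ⁻¹) ≈ 1#
      h≈⇒h[x*y⁻¹]≈1 {x} {y} y≉0 hx≈hy = trans (h-* x (y ⁻¹)) (trans (*-congʳ hx≈hy) (h-⁻¹ y≉0))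

      h≈⇒≈± : ∀ {x y} → x ≉ 0# → y ≉ 0# → h x ≈ h y → x ≈ y ⊎ x ≈ - y
      h≈⇒≈± {x} {y} x≉0 y≉0 hx≈hy
        with h≈1⇒≈±1 (*-nonzero x≉0 (⁻¹-nonzero y≉0)) (h≈⇒h[x*y⁻¹]≈1 y≉0 hx≈hy)
      ... | inj₁ t≈1  = inj₁ (trans (x≈[x*y⁻¹]*y y≉0) (trans (*-congʳ t≈1) (*-identityˡ y)))
      ... | inj₂ t≈-1 = inj₂ (trans (x≈[x*y⁻¹]*y y≉0) (trans (*-congʳ t≈-1) (-1*x≈-x y)))

      value? : ∀ c → Dec (∃ λ x → h x ≈ c)
      value? c = any? (λ x≈y hx≈c → trans (h-cong (sym x≈y)) hx≈c) (λ x → h x ≟ c)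

      Nonvalue : Carrier → Set (c ⊔ ℓ)
      Nonvalue y = y ≉ 0# × ¬ ∃ λ x → h x ≈ y

      Nonvalue-resp : Nonvalue Respects _≈_
      Nonvalue-resp y≈y′ (y≉0 , ¬value) =
        (λ y′≈0 → y≉0 (trans y≈y′ y′≈0)) , λ (x , hx≈y′) → ¬value (x , trans hx≈y′ (sym y≈y′))

      abstract
        ∃nonvalue : ∃ λ c → c ≉ 0# × (∀ x → h x ≉ c)
        ∃nonvalue with any? Nonvalue-resp (λ y → ¬? (y ≟ 0#) ×-dec ¬? (value? y))
        ... | yes (c , c≉0 , ¬value) = c , c≉0 , λ x hx≈c → ¬value (x , hx≈c)
        ... | no  ¬nonvalue =
          -- otherwise h would be onto, hence one-to-one, yet h 1 ≈ h (- 1)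
          contradiction (surjective⇒injective h h-cong onto (sym (h-neg 1#))) (x≉-x 1≉-1 1≉0)
          where
          onto : ∀ y → ∃ λ x → h x ≈ y
          onto y with y ≟ 0# | value? y
          ... | yes y≈0 | _         = 0# , trans h-0 (sym y≈0)
          ... | no  _   | yes value = value
          ... | no  y≉0 | no ¬value = contradiction (y , y≉0 , ¬value) ¬nonvalue

      module _ {c} (c≉0 : c ≉ 0#) (c-nonvalue : ∀ x → h x ≉ c) where

        open Representatives -_ -‿cong -‿involutive

        h≉c*h : ∀ {x y} → y ≉ 0# → h x ≉ c * h y
        h≉c*h {x} {y} y≉0 hx≈c*hy = c-nonvalue (x * y ⁻¹) (begin
          h (x * y ⁻¹)          ≈⟨ h-* x (y ⁻¹) ⟩
          h x * h (y ⁻¹)        ≈⟨ *-congʳ hx≈c*hy ⟩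
          (c * h y) * h (y ⁻¹)  ≈⟨ *-assoc _ _ _ ⟩
          c * (h y * h (y ⁻¹))  ≈⟨ *-congˡ (h-⁻¹ y≉0) ⟩
          c * 1#                ≈⟨ *-identityʳ c ⟩
          c                     ∎)

        -- Φ sends the preferred one of ± x to h x and the other one to c * h x.
        -- It is injective, hence onto since the field is finite.
        Φ′ : ∀ x → Dec (x ≈ 0#) → Dec (Preferred x) → Carrier
        Φ′ x (yes _) _       = 0#
        Φ′ x (no _)  (yes _) = h x
        Φ′ x (no _)  (no _)  = c * h x

        Φ : Carrier → Carrier
        Φ x = Φ′ x (x ≟ 0#) (preferred? x)

        Φ′-injective : ∀ {x y} (x≟0 : Dec (x ≈ 0#)) (px? : Dec (Preferred x))
                       (y≟0 : Dec (y ≈ 0#)) (py? : Dec (Preferred y)) →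
                       Φ′ x x≟0 px? ≈ Φ′ y y≟0 py? → x ≈ y
        Φ′-injective (yes x≈0) _ (yes y≈0) _ _ = trans x≈0 (sym y≈0)
        Φ′-injective (yes _) _ (no y≉0) (yes _) 0≈hy = contradiction (sym 0≈hy) (h-nonzero y≉0)
        Φ′-injective (yes _) _ (no y≉0) (no _) 0≈chy = contradiction (sym 0≈chy) (*-nonzero c≉0 (h-nonzero y≉0))
        Φ′-injective (no x≉0) (yes _) (yes _) _ hx≈0 = contradiction hx≈0 (h-nonzero x≉0)
        Φ′-injective (no x≉0) (no _) (yes _) _ chx≈0 = contradiction chx≈0 (*-nonzero c≉0 (h-nonzero x≉0))
        Φ′-injective (no _) (yes _) (no y≉0) (no _) hx≈chy = contradiction hx≈chy (h≉c*h y≉0)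
        Φ′-injective (no x≉0) (no _) (no _) (yes _) chx≈hy = contradiction (sym chx≈hy) (h≉c*h x≉0)
        Φ′-injective (no x≉0) (yes px) (no y≉0) (yes py) hx≈hy with h≈⇒≈± x≉0 y≉0 hx≈hy
        ... | inj₁ x≈y  = x≈y
        ... | inj₂ x≈-y = contradiction (Preferred-resp x≈-y px) (¬Preferred-both py)
        Φ′-injective (no x≉0) (no ¬px) (no y≉0) (no ¬py) chx≈chy
          with h≈⇒≈± x≉0 y≉0 (*-cancelˡ c≉0 chx≈chy)
        ... | inj₁ x≈y  = x≈y
        ... | inj₂ x≈-y with preferred-or-ι (x≉-x 1≉-1 y≉0)
        ...   | inj₁ py  = contradiction py ¬py
        ...   | inj₂ p-y = contradiction (Preferred-resp (sym x≈-y) p-y) ¬px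

        Φ-injective : ∀ {x y} → Φ x ≈ Φ y → x ≈ y
        Φ-injective {x} {y} = Φ′-injective (x ≟ 0#) (preferred? x) (y ≟ 0#) (preferred? y)

        Φ′-classify : ∀ {x y} → y ≉ 0# → (x≟0 : Dec (x ≈ 0#)) (px? : Dec (Preferred x)) →
                      Φ′ x x≟0 px? ≈ y →
                      (∃ λ x → x ≉ 0# × h x ≈ y) ⊎ (∃ λ x → x ≉ 0# × c * h x ≈ y)
        Φ′-classify y≉0 (yes _)   _       0≈y   = contradiction (sym 0≈y) y≉0
        Φ′-classify y≉0 (no x≉0) (yes _) hx≈y  = inj₁ (_ , x≉0 , hx≈y)
        Φ′-classify y≉0 (no x≉0) (no _)  chx≈y = inj₂ (_ , x≉0 , chx≈y)

        -- Kept abstract: unfolding the search for a preimage makes the users of this lemma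
        -- very expensive to check.
        abstract
          value-or-twisted : ∀ {y} → y ≉ 0# →
            (∃ λ x → x ≉ 0# × h x ≈ y) ⊎ (∃ λ x → x ≉ 0# × c * h x ≈ y)
          value-or-twisted {y} y≉0 with x , Φx≈y ← injective⇒surjective Φ Φ-injective y =
            Φ′-classify y≉0 (x ≟ 0#) (preferred? x) Φx≈y

    isSquare? : ∀ m → Dec (IsSquare m)
    isSquare? m = any? (λ x≈y xx≈m → trans (*-cong (sym x≈y) (sym x≈y)) xx≈m) (λ y → (y * y) ≟ m)

    module NetReplacement {ρ ρinv : Carrier → Carrier} (A : IsAutomorphism ρ ρinv)
                          (-1∉ρ-1 : MinusOneNotRhoMinusOne ρ) where

      open AutomorphismProperties A
      private module ρinvₚ = AutomorphismProperties (inverse-isAutomorphism A)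

      ρx≉-x : ∀ {x} → x ≉ 0# → ρ x ≉ - x
      ρx≉-x {x} x≉0 ρx≈-x = -1∉ρ-1 x x≉0 (begin
        ρ x * x ⁻¹    ≈⟨ *-congʳ ρx≈-x ⟩
        - x * x ⁻¹    ≈⟨ -‿distribˡ-* x (x ⁻¹) ⟨
        - (x * x ⁻¹)  ≈⟨ -‿cong (inverseʳ x x≉0) ⟩
        - 1#          ∎)

      ρx≈-x⇒x≈0 : ∀ {x} → ρ x ≈ - x → x ≈ 0#
      ρx≈-x⇒x≈0 {x} ρx≈-x with x ≟ 0#
      ... | yes x≈0 = x≈0
      ... | no  x≉0 = contradiction ρx≈-x (ρx≉-x x≉0)

      1≉-1 : 1# ≉ - 1#
      1≉-1 1≈-1 = ρx≉-x 1≉0 (trans ρ-1 1≈-1)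

      x+ρx-injective : ∀ {x y} → x + ρ x ≈ y + ρ y → x ≈ y
      x+ρx-injective = sub-injective (λ x → x + ρ x)
        (λ x y → trans (+-congˡ (ρ-sub x y)) ([a-b]+[c-d]≈[a+c]-[b+d] x y (ρ x) (ρ y)))
        (λ x+ρx≈0 → ρx≈-x⇒x≈0 (+-inverseʳ-unique _ _ x+ρx≈0))

      T : Carrier → Carrier
      T u = ρinv u + ρ u

      T≈0⇒ρ[u*ρu]≈-[u*ρu] : ∀ {u} → T u ≈ 0# → ρ (u * ρ u) ≈ - (u * ρ u)
      T≈0⇒ρ[u*ρu]≈-[u*ρu] {u} Tu≈0 = begin
        ρ (u * ρ u)    ≈⟨ ρ-* u (ρ u) ⟩
        ρ u * ρ (ρ u)  ≈⟨ *-congˡ ρρu≈-u ⟩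
        ρ u * - u      ≈⟨ -‿distribʳ-* (ρ u) u ⟨
        - (ρ u * u)    ≈⟨ -‿cong (*-comm _ _) ⟩
        - (u * ρ u)    ∎
        where
        ρρu≈-u : ρ (ρ u) ≈ - u
        ρρu≈-u = begin
          ρ (ρ u)       ≈⟨ ρ-cong (+-inverseʳ-unique (ρinv u) (ρ u) Tu≈0) ⟩
          ρ (- ρinv u)  ≈⟨ ρ-neg (ρinv u) ⟩
          - ρ (ρinv u)  ≈⟨ -‿cong (ρ∘ρinv u) ⟩
          - u           ∎

      T≈0⇒≈0 : ∀ {u} → T u ≈ 0# → u ≈ 0#
      T≈0⇒≈0 Tu≈0 with x*y≈0⇒x≈0⊎y≈0 (ρx≈-x⇒x≈0 (T≈0⇒ρ[u*ρu]≈-[u*ρu] Tu≈0))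
      ... | inj₁ u≈0  = u≈0
      ... | inj₂ ρu≈0 = ρ-injective (trans ρu≈0 (sym ρ-0))

      T-cong : ∀ {x y} → x ≈ y → T x ≈ T y
      T-cong x≈y = +-cong (ρinvₚ.ρ-cong x≈y) (ρ-cong x≈y)

      T-injective : ∀ {x y} → T x ≈ T y → x ≈ y
      T-injective = sub-injective T
        (λ x y → trans (+-cong (ρinvₚ.ρ-sub x y) (ρ-sub x y)) ([a-b]+[c-d]≈[a+c]-[b+d] _ _ _ _))
        T≈0⇒≈0

      module Squares = IndexTwo 1≉-1 (λ x → x * x) (λ x≈y → *-cong x≈y x≈y)
        [x*y]*[x*y]≈[x*x]*[y*y] (*-identityˡ 1#) (zeroˡ 0#) (λ x≉0 → *-nonzero x≉0 x≉0)
        (λ x → -x*-y≈x*y x x) (λ _ tt≈1 → x*x≈y*y⇒x≈±y (trans tt≈1 (sym (*-identityˡ 1#))))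

      norm : Carrier → Carrier
      norm s = s * ρinv s

      norm-cong : ∀ {x y} → x ≈ y → norm x ≈ norm y
      norm-cong x≈y = *-cong x≈y (ρinvₚ.ρ-cong x≈y)

      norm-* : ∀ x y → norm (x * y) ≈ norm x * norm y
      norm-* x y = trans (*-congˡ (ρinvₚ.ρ-* x y))
        (solve 4 (λ x y a b → (x :* y) :* (a :* b) := (x :* a) :* (y :* b)) refl x y (ρinv x) (ρinv y))

      norm-nonzero : ∀ {x} → x ≉ 0# → norm x ≉ 0#
      norm-nonzero x≉0 = *-nonzero x≉0 (ρinvₚ.ρ-nonzero x≉0)

      ρ-norm : ∀ x → ρ (norm x) ≈ ρ x * x
      ρ-norm x = trans (ρ-* x (ρinv x)) (*-congˡ (ρ∘ρinv x))

      -- With z = t - t⁻¹, ρinv t ≈ t⁻¹ forces ρ z ≈ - z.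
      norm≈1⇒≈±1 : ∀ {t} → t ≉ 0# → norm t ≈ 1# → t ≈ 1# ⊎ t ≈ - 1#
      norm≈1⇒≈±1 {t} t≉0 Nt≈1 =
        x*x≈y*y⇒x≈±y (trans (*-congˡ t≈t⁻¹) (trans (inverseʳ t t≉0) (sym (*-identityˡ 1#))))
        where
        ρinv-t : ρinv t ≈ t ⁻¹
        ρinv-t = x*y≈1⇒y≈x⁻¹ Nt≈1
        ρinv-z : ρinv (t - t ⁻¹) ≈ - (t - t ⁻¹)
        ρinv-z = begin
          ρinv (t - t ⁻¹)        ≈⟨ ρinvₚ.ρ-sub t (t ⁻¹) ⟩
          ρinv t - ρinv (t ⁻¹)   ≈⟨ +-cong ρinv-t (-‿cong (ρinvₚ.ρ-⁻¹ t≉0)) ⟩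
          t ⁻¹ - ρinv t ⁻¹       ≈⟨ +-congˡ (-‿cong (trans (⁻¹-cong ρinv-t) (⁻¹-involutive t≉0))) ⟩
          t ⁻¹ - t               ≈⟨ ⁻¹-anti-homo‿- t (t ⁻¹) ⟨
          - (t - t ⁻¹)           ∎
        t≈t⁻¹ : t ≈ t ⁻¹
        t≈t⁻¹ = x∙y⁻¹≈ε⇒x≈y t (t ⁻¹) (ρx≈-x⇒x≈0 (ρinv-anti⇒ρ-anti ρinv-z))

      module Norms = IndexTwo 1≉-1 norm norm-cong norm-* (trans (*-identityˡ _) ρinvₚ.ρ-1)
        (zeroˡ _) norm-nonzero (λ x → trans (*-congˡ (ρinvₚ.ρ-neg x)) (-x*-y≈x*y x (ρinv x)))
        norm≈1⇒≈±1

      ρinv-of-nonsquare : ∀ {d} → d ≉ 0# → (∀ x → x * x ≉ d) → ∃ λ b → d * (b * b) ≈ ρinv d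
      ρinv-of-nonsquare {d} d≉0 d-nonsquare
        with Squares.value-or-twisted d≉0 d-nonsquare (ρinvₚ.ρ-nonzero d≉0)
      ... | inj₁ (x , _ , xx≈ρinvd) =
        contradiction (trans (sym (ρ-* x x)) (trans (ρ-cong xx≈ρinvd) (ρ∘ρinv d))) (d-nonsquare (ρ x))
      ... | inj₂ (b , _ , d*bb≈ρinvd) = b , d*bb≈ρinvd

      norm-isSquare : ∀ {s} → s ≉ 0# → IsSquare (norm s)
      norm-isSquare {s} s≉0 with Squares.∃nonvalue
      ... | d , d≉0 , d-nonsquare with Squares.value-or-twisted d≉0 d-nonsquare s≉0
      ...   | inj₁ (t , _ , tt≈s) = norm t , (begin
        norm t * norm t  ≈⟨ norm-* t t ⟨
        norm (t * t)     ≈⟨ norm-cong tt≈s ⟩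
        norm s           ∎)
      ...   | inj₂ (t , _ , d*tt≈s) with b , d*bb≈ρinvd ← ρinv-of-nonsquare d≉0 d-nonsquare =
        (d * b) * norm t , (begin
        ((d * b) * norm t) * ((d * b) * norm t)  ≈⟨ [x*y]*[x*y]≈[x*x]*[y*y] _ _ ⟩
        ((d * b) * (d * b)) * (norm t * norm t)  ≈⟨ *-cong ([x*y]*[x*y]≈[x*x]*[y*y] d b) (sym (norm-* t t)) ⟩
        ((d * d) * (b * b)) * norm (t * t)       ≈⟨ *-congʳ (trans (*-assoc d d (b * b)) (*-congˡ d*bb≈ρinvd)) ⟩
        norm d * norm (t * t)                    ≈⟨ norm-* d (t * t) ⟨
        norm (d * (t * t))                       ≈⟨ norm-cong d*tt≈s ⟩
        norm s                                   ∎)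

      nonnorm-isNonsquare : ∀ {c} → c ≉ 0# → (∀ x → norm x ≉ c) → ¬ IsSquare c
      nonnorm-isNonsquare {c} c≉0 c-nonnorm (k , kk≈c) with Squares.∃nonvalue
      ... | d , d≉0 , d-nonsquare with Norms.value-or-twisted c≉0 c-nonnorm d≉0
      ...   | inj₁ (x , x≉0 , Nx≈d) =
        let a , aa≈Nx = norm-isSquare x≉0 in d-nonsquare a (trans aa≈Nx Nx≈d)
      ...   | inj₂ (x , x≉0 , c*Nx≈d) =
        let a , aa≈Nx = norm-isSquare x≉0 in
        d-nonsquare (k * a) (trans ([x*y]*[x*y]≈[x*x]*[y*y] k a) (trans (*-cong kk≈c aa≈Nx) c*Nx≈d))

      square-isNorm : ∀ {b} → b ≉ 0# → ∃ λ s → s ≉ 0# × norm s ≈ b * b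
      square-isNorm {b} b≉0 with Norms.∃nonvalue
      ... | c , c≉0 , c-nonnorm with Norms.value-or-twisted c≉0 c-nonnorm (*-nonzero b≉0 b≉0)
      ...   | inj₁ norm-preimage = norm-preimage
      ...   | inj₂ (x , x≉0 , c*Nx≈bb) =
        let a , aa≈Nx = norm-isSquare x≉0 in
        contradiction (quotient-isSquare (x*x≈y⇒x≉0 (norm-nonzero x≉0) aa≈Nx) (trans (*-congˡ aa≈Nx) c*Nx≈bb))
                      (nonnorm-isNonsquare c≉0 c-nonnorm)

      -- The subspaces W_m

      W-value-cong : ∀ m {x y} → x ≈ y → m * ρinv x + ρ m * ρ x ≈ m * ρinv y + ρ m * ρ y
      W-value-cong m x≈y = +-cong (*-congˡ (ρinvₚ.ρ-cong x≈y)) (*-congˡ (ρ-cong x≈y))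

      W-cong : ∀ {m m′} → m ≈ m′ → W ρ ρinv m ≐ W ρ ρinv m′
      W-cong m≈m′ = graph-cong (λ x → +-cong (*-congʳ m≈m′) (*-congʳ (ρ-cong m≈m′)))

      W-injective : ∀ {m m′} → W ρ ρinv m ≐ W ρ ρinv m′ → m ≈ m′
      W-injective {m} {m′} W≐W′ = x+ρx-injective (begin
        m + ρ m                         ≈⟨ value-at-1 m ⟨
        m * ρinv 1# + ρ m * ρ 1#        ≈⟨ graph-≐⇒≈ (W-value-cong m′) W≐W′ 1# ⟩
        m′ * ρinv 1# + ρ m′ * ρ 1#      ≈⟨ value-at-1 m′ ⟩
        m′ + ρ m′                       ∎)
        where
        value-at-1 : ∀ k → k * ρinv 1# + ρ k * ρ 1# ≈ k + ρ k
        value-at-1 k = +-cong (trans (*-congˡ ρinvₚ.ρ-1) (*-identityʳ k)) (trans (*-congˡ ρ-1) (*-identityʳ (ρ k)))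

      W-value-at-0 : ∀ m {x} → x ≈ 0# → m * ρinv x + ρ m * ρ x ≈ 0#
      W-value-at-0 m x≈0 = trans (W-value-cong m x≈0)
        (trans (+-cong (trans (*-congˡ ρinvₚ.ρ-0) (zeroʳ m)) (trans (*-congˡ ρ-0) (zeroʳ (ρ m)))) (+-identityˡ 0#))

      W0≐Xaxis : W ρ ρinv 0# ≐ Xaxis
      W0≐Xaxis = graph-cong (λ x → trans (+-cong (zeroˡ _) (trans (*-congʳ ρ-0) (zeroˡ _))) (+-identityˡ 0#))

      Yaxis≉W : ∀ {m} → ¬ (Yaxis ≐ W ρ ρinv m)
      Yaxis≉W {m} Y≐W with x , 0≈x , 1≈ ← proj₁ (Y≐W 0# 1#) (1# , refl , refl) =
        1≉0 (trans 1≈ (W-value-at-0 m (sym 0≈x)))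

      W₁-value : ∀ x → 1# * ρinv x + ρ 1# * ρ x ≈ T x
      W₁-value x = +-cong (*-identityˡ _) (trans (*-congʳ ρ-1) (*-identityˡ _))

      σW₁≐graph : ∀ {s} → s ≉ 0# → σ ρ ρinv s (W ρ ρinv 1#) ≐ Graph (λ x → s ⁻¹ * T (s ⁻¹ * x))
      σW₁≐graph {s} s≉0 = ≐-trans (σ-graph ρ ρinv s≉0 (W-value-cong 1#))
                                  (graph-cong (λ x → *-congˡ (W₁-value (s ⁻¹ * x))))

      T-scaled : ∀ u x → u * T (u * x) ≈ norm u * ρinv x + ρ (norm u) * ρ x
      T-scaled u x = begin
        u * (ρinv (u * x) + ρ (u * x))               ≈⟨ *-congˡ (+-cong (ρinvₚ.ρ-* u x) (ρ-* u x)) ⟩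
        u * (ρinv u * ρinv x + ρ u * ρ x)
          ≈⟨ solve 5 (λ u a b c d → u :* (a :* b :+ c :* d) := (u :* a) :* b :+ (c :* u) :* d) refl
                     u (ρinv u) (ρinv x) (ρ u) (ρ x) ⟩
        norm u * ρinv x + (ρ u * u) * ρ x            ≈⟨ +-congˡ (*-congʳ (ρ-norm u)) ⟨
        norm u * ρinv x + ρ (norm u) * ρ x           ∎

      σW₁≐W : ∀ {s} → s ≉ 0# → σ ρ ρinv s (W ρ ρinv 1#) ≐ W ρ ρinv (norm (s ⁻¹))
      σW₁≐W s≉0 = ≐-trans (σW₁≐graph s≉0) (graph-cong (T-scaled _))

      InN⇒≐W : ∀ {U} → InN ρ ρinv U → ∃ λ m → m ≉ 0# × IsSquare m × U ≐ W ρ ρinv m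
      InN⇒≐W (s , s≉0 , U≐σ) = norm (s ⁻¹) , norm-nonzero s⁻¹≉0 , norm-isSquare s⁻¹≉0
                             , ≐-trans U≐σ (σW₁≐W s≉0)
        where
        s⁻¹≉0 : s ⁻¹ ≉ 0#
        s⁻¹≉0 = ⁻¹-nonzero s≉0

      ≐W⇒InN : ∀ {U m} → m ≉ 0# → IsSquare m → U ≐ W ρ ρinv m → InN ρ ρinv U
      ≐W⇒InN {U} {m} m≉0 (b , bb≈m) U≐W with s , s≉0 , Ns≈bb ← square-isNorm (x*x≈y⇒x≉0 m≉0 bb≈m) =
        s ⁻¹ , ⁻¹-nonzero s≉0 , ≐-trans U≐W (≐-trans (W-cong m≈N[s⁻¹⁻¹]) (≐-sym (σW₁≐W (⁻¹-nonzero s≉0))))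
        where
        m≈N[s⁻¹⁻¹] : m ≈ norm (s ⁻¹ ⁻¹)
        m≈N[s⁻¹⁻¹] = trans (sym bb≈m) (trans (sym Ns≈bb) (norm-cong (sym (⁻¹-involutive s≉0))))

      Xaxis∉N : ∀ {U} → U ≐ Xaxis → ¬ InN ρ ρinv U
      Xaxis∉N U≐X U∈N with m , m≉0 , _ , U≐W ← InN⇒≐W U∈N =
        m≉0 (W-injective (≐-trans (≐-sym U≐W) (≐-trans U≐X (≐-sym W0≐Xaxis))))

      Yaxis∉N : ∀ {U} → U ≐ Yaxis → ¬ InN ρ ρinv U
      Yaxis∉N U≐Y U∈N with _ , _ , _ , U≐W ← InN⇒≐W U∈N = Yaxis≉W (≐-trans (≐-sym U≐Y) U≐W)

      nonsquare-W∉N : ∀ {U m} → ¬ IsSquare m → U ≐ W ρ ρinv m → ¬ InN ρ ρinv U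
      nonsquare-W∉N m-nonsquare U≐W U∈N with m′ , _ , (b , bb≈m′) , U≐W′ ← InN⇒≐W U∈N =
        m-nonsquare (b , trans bb≈m′ (W-injective (≐-trans (≐-sym U≐W′) U≐W)))

      module _ (β : Carrier → Carrier) (β∘T : ∀ u → β (T u) ≈ u) (T∘β : ∀ v → T (β v) ≈ v) where

        β-cong : ∀ {x y} → x ≈ y → β x ≈ β y
        β-cong x≈y = T-injective (trans (T∘β _) (trans x≈y (sym (T∘β _))))

        τσW₁≐G : ∀ {s} → s ≉ 0# → τ ρ ρinv (σ ρ ρinv s (W ρ ρinv 1#)) ≐ G ρ ρinv β s
        τσW₁≐G {s} s≉0 = ≐-trans (τ-cong ρ ρinv (σW₁≐graph s≉0))
                                 (τ-graph ρ ρinv (λ x≈y → *-congˡ (β-cong (*-congʳ x≈y))) φ∘χ χ∘φ)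
          where
          φ χ : Carrier → Carrier
          φ x = s ⁻¹ * T (s ⁻¹ * x)
          χ x = s * β (x * s)
          φ∘χ : ∀ x → φ (χ x) ≈ x
          φ∘χ x = begin
            s ⁻¹ * T (s ⁻¹ * (s * β (x * s)))  ≈⟨ *-congˡ (T-cong (x⁻¹*[x*y]≈y s≉0 _)) ⟩
            s ⁻¹ * T (β (x * s))              ≈⟨ *-congˡ (T∘β (x * s)) ⟩
            s ⁻¹ * (x * s)                    ≈⟨ *-congˡ (*-comm x s) ⟩
            s ⁻¹ * (s * x)                    ≈⟨ x⁻¹*[x*y]≈y s≉0 x ⟩
            x                                 ∎
          χ∘φ : ∀ y → χ (φ y) ≈ y
          χ∘φ y = begin
            s * β ((s ⁻¹ * T (s ⁻¹ * y)) * s)  ≈⟨ *-congˡ (β-cong (trans (*-comm _ s) (x*[x⁻¹*y]≈y s≉0 _))) ⟩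
            s * β (T (s ⁻¹ * y))              ≈⟨ *-congˡ (β∘T (s ⁻¹ * y)) ⟩
            s * (s ⁻¹ * y)                    ≈⟨ x*[x⁻¹*y]≈y s≉0 y ⟩
            y                                 ∎

        Σ′⇒Listed : ∀ U → InΣ′ ρ ρinv U → Listed ρ ρinv β U
        Σ′⇒Listed U (inj₁ (inj₁ U≐Y , _)) = inj₂ (inj₁ U≐Y)
        Σ′⇒Listed U (inj₁ (inj₂ (m , U≐W) , U∉N)) with m ≟ 0# | isSquare? m
        ... | yes m≈0 | _           = inj₁ (≐-trans U≐W (≐-trans (W-cong m≈0) W0≐Xaxis))
        ... | no m≉0  | yes square  = contradiction (≐W⇒InN m≉0 square U≐W) U∉N
        ... | no m≉0  | no ¬square  = inj₂ (inj₂ (inj₁ (m , m≉0 , ¬square , U≐W)))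
        Σ′⇒Listed U (inj₂ (V , (s , s≉0 , V≐σ) , U≐τV)) =
          inj₂ (inj₂ (inj₂ (s , s≉0 , ≐-trans U≐τV (≐-trans (τ-cong ρ ρinv V≐σ) (τσW₁≐G s≉0)))))

        Listed⇒Σ′ : ∀ U → Listed ρ ρinv β U → InΣ′ ρ ρinv U
        Listed⇒Σ′ U (inj₁ U≐X) = inj₁ (inj₂ (0# , ≐-trans U≐X (≐-sym W0≐Xaxis)) , Xaxis∉N U≐X)
        Listed⇒Σ′ U (inj₂ (inj₁ U≐Y)) = inj₁ (inj₁ U≐Y , Yaxis∉N U≐Y)
        Listed⇒Σ′ U (inj₂ (inj₂ (inj₁ (m , _ , ¬square , U≐W)))) =
          inj₁ (inj₂ (m , U≐W) , nonsquare-W∉N ¬square U≐W)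
        Listed⇒Σ′ U (inj₂ (inj₂ (inj₂ (s , s≉0 , U≐G)))) =
          inj₂ (σ ρ ρinv s (W ρ ρinv 1#) , (s , s≉0 , ≐-refl) , ≐-trans U≐G (≐-sym (τσW₁≐G s≉0)))

corollary3p7 :
  ∀ {c ℓ} (R : CommutativeRing c ℓ) (K : IsField R) →
  let open CommutativeRing R
      open FieldDefs R K
  in FiniteOfOddOrder →
     (ρ ρinv : Carrier → Carrier) → IsAutomorphism ρ ρinv →
     Nontrivial ρ →
     MinusOneNotRhoMinusOne ρ →
     (β : Carrier → Carrier) →
     (∀ u → β (ρinv u + ρ u) ≈ u) →
     (∀ v → (ρinv (β v) + ρ (β v)) ≈ v) →
     ∀ (U : Sub) →
       (InΣ′ ρ ρinv U → Listed ρ ρinv β U) × (Listed ρ ρinv β U → InΣ′ ρ ρinv U)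
corollary3p7 R K fin ρ ρinv A _ -1∉ρ-1 β β∘T T∘β U =
  Σ′⇒Listed β β∘T T∘β U , Listed⇒Σ′ β β∘T T∘β U
  where open FieldProperties.FiniteFieldProperties.NetReplacement R K fin A -1∉ρ-1
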